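{- Let $\lambda\geq 1$. Let $\langle U,\mathfrak{F}\rangle$ be a SET-COVER instance and let $\langle G,s\rangle$ with parameter $k$ be the instance obtained from it by the transformation described in the context. Then from any $(\lambda,k)$-FT-BFP $H$ of $G$ (with source $s$) one can construct a solution of the SET-COVER instance $\langle U,\mathfrak{F}\rangle$ of size at most $\lambda^{ -1}\min_{1\leq j\leq N}|\textsc{in}(v_j,H)|$.
   Context: A SET-COVER instance consists of a base set $U$ and subsets $\mathfrak{F}=\{S_1,\dots,S_m\}$ of $U$ with union $U$; a solution is a subfamily whose union is $U$. Transformation: (1) Pad $U$ to size $2^u$ (the nearest power of $2$) by adding $2^u-|U|$ new elements to $U$ and adding all of them to every set of $\mathfrak{F}$. (2) Start with $N+1$ vertices $s,v_1,\dots,v_N$ where $N=4\lambda(m+n)$, $n=|U|$, $m=|\mathfrak{F}|$. (3) For each $i\in[1,\lambda]$: build a complete binary tree $B_i$ (edges directed from parent to child) rooted at $r_i$ of height $u$ with $2^u$ leaves, the leaves $x_i$ corresponding to the elements $x\in U$; from each leaf $x_i$ add edges to two new vertices $\ell(x_i)$ and $r(x_i)$; for each $W\in\mathfrak{F}$ add a vertex $y_{i,W}$ (these form the set $Y_i$) and add the edge $(\ell(x_i),y_{i,W})$ iff $x\in W$; add a set $Z_i$ of $u+1$ new vertices and add an edge from each $r(x_i)$ to every vertex of $Z_i$. (4) Add edges $(s,r_i)$ for all $i\in[1,\lambda]$, and for each $i$ add an edge from every vertex of $Y_i\cup Z_i$ to every vertex $v_1,\dots,v_N$. Set $k=u+1$.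 Notation: $\textsc{in}(v,H)$ is the set of in-neighbours of $v$ in $H$. Edges have unit capacity; $\textsc{max-flow}(s,t,G)$ is the maximum number of edge-disjoint $s$-to-$t$ paths and $G\setminus F$ is $G$ with edges of $F$ deleted. A $(\lambda,k)$-FT-BFP of $G$ with source $s$ is a subgraph $H=(V,E_H)$, $E_H\subseteq E(G)$, such that for every $F\subseteq E(G)$ with $|F|\leq k$ and every vertex $t$: if $\textsc{max-flow}(s,t,G\setminus F)\leq\lambda$ then $\textsc{max-flow}(s,t,H\setminus F)=\textsc{max-flow}(s,t,G\setminus F)$, and otherwise $\textsc{max-flow}(s,t,H\setminus F)\geq\lambda$. -}

module Defs where

open import Data.Bool using (Bool; true; false; _∧_; _∨_; T; if_then_else_)
open import Data.Nat using (ℕ; zero; suc; _+_; _*_; _^_; _≤_; _<_; _≡ᵇ_; _<?_)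
open import Data.Nat.Logarithm using (⌈log₂_⌉)
open import Data.Fin using (Fin; toℕ; fromℕ<)
open import Data.Fin.Subset using (Subset; Side; inside; outside; _∈_; ∣_∣)
open import Data.Vec using (lookup)
open import Data.List using (List; []; _∷_; _++_; map; concatMap; allFin; length)
open import Data.List.Relation.Unary.All using (All)
open import Data.List.Relation.Unary.Unique.Propositional using (Unique)
import Data.List.Membership.Propositional as LMem
open import Data.Product using (Σ; ∃; _×_; _,_; proj₁; proj₂)
open import Relation.Nullary using (¬_; yes; no)
open import Relation.Binary.PropositionalEquality using (_≡_; _≢_)

module _ {V : Set} where

  Graph : Set
  Graph = V → V → Bool

  EdgeRel : Set₁
  EdgeRel = V → V → Set

  edgesOf : Graph → EdgeRel
  edgesOf G u v = T (G u v)

  _∖_ : Graph → List (V × V) → EdgeRel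
  (G ∖ F) u v = T (G u v) × ¬ (LMem._∈_ (u , v) F)

  data Walk (E : EdgeRel) : V → V → Set where
    stop : ∀ {v} → Walk E v v
    step : ∀ {u v w} → E u v → Walk E v w → Walk E u w

  walkVerts : ∀ {E u w} → Walk E u w → List V
  walkVerts {u = u} stop = u ∷ []
  walkVerts (step {u = u} _ p) = u ∷ walkVerts p

  walkEdges : ∀ {E u w} → Walk E u w → List (V × V)
  walkEdges stop = []
  walkEdges (step {u = u} {v = v} _ p) = (u , v) ∷ walkEdges p

  Path : EdgeRel → V → V → Set
  Path E s t = Σ (Walk E s t) λ p → Unique (walkVerts p)

  HasFlow : EdgeRel → V → V → ℕ → Set
  HasFlow E s t c =
    Σ (Fin c → Path E s t) λ ps →
      ∀ i j → i ≢ j → ∀ e →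
        LMem._∈_ e (walkEdges (proj₁ (ps i))) →
        ¬ LMem._∈_ e (walkEdges (proj₁ (ps j)))

  -- max-flow(s,t,E) = c : the maximum number of edge-disjoint s-t paths is c
  IsMaxFlow : EdgeRel → V → V → ℕ → Set
  IsMaxFlow E s t c = HasFlow E s t c × (∀ c' → HasFlow E s t c' → c' ≤ c)

  Subgraph : Graph → Graph → Set
  Subgraph H G = ∀ u v → T (H u v) → T (G u v)

  -- Fault sets F ⊆ E(G) with |F| ≤ k are given as lists of edges of G of
  -- length ≤ k.  "max-flow(s,t,H∖F) ≥ λ" is written as: λ edge-disjoint
  -- s-t paths exist in H∖F.
  IsFTBFP : Graph → V → ℕ → ℕ → Graph → Set
  IsFTBFP G s lam k H =
    Subgraph H G ×
    (∀ (F : List (V × V)) → length F ≤ k →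
       All (λ e → T (G (proj₁ e) (proj₂ e))) F →
       ∀ (t : V) (c : ℕ) → IsMaxFlow (G ∖ F) s t c →
         (c ≤ lam → IsMaxFlow (H ∖ F) s t c) ×
         (lam < c → HasFlow (H ∖ F) s t lam))

  countIn : Graph → List V → V → ℕ
  countIn H [] v = 0
  countIn H (w ∷ ws) v = (if H w v then 1 else 0) + countIn H ws v

-- instance: base set U = Fin n, family S₁..Sₘ as subsets of Fin n
-- whose union is U
IsSetCoverInstance : ∀ {n m} → (Fin m → Subset n) → Set
IsSetCoverInstance {n} {m} S = ∀ (x : Fin n) → ∃ λ (W : Fin m) → x ∈ S W

IsCover : ∀ {n m} → (Fin m → Subset n) → Subset m → Set
IsCover {n} {m} S C = ∀ (x : Fin n) → ∃ λ (W : Fin m) → W ∈ C × x ∈ S W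

-- (1) padding: 2^u is the smallest power of two ≥ n
uOf : ℕ → ℕ
uOf n = ⌈log₂ n ⌉

sideB : Side → Bool
sideB inside = true
sideB outside = false

-- membership of padded element x ∈ Fin (2^u) in padded set W:
-- original elements (x < n) as in S W, new elements in every set
padMem : ∀ {n m} → (Fin m → Subset n) → Fin m → Fin (2 ^ uOf n) → Bool
padMem {n} S W x with toℕ x <? n
... | yes p = sideB (lookup (S W) (fromℕ< p))
... | no _  = true

-- N = 4 λ (m + n) with n = |U| the (padded) base set size
NOf : ℕ → ℕ → ℕ → ℕ
NOf lam n m = 4 * lam * (m + 2 ^ uOf n)

kOf : ℕ → ℕ
kOf n = suc (uOf n)

-- vertices of G; tree nodes of B_i are (depth d, position a), the leaves
-- being the depth-u nodes, leaf a corresponding to padded element a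
data Vtx (lam u m N : ℕ) : Set where
  src  : Vtx lam u m N
  vv   : Fin N → Vtx lam u m N
  node : Fin lam → (d : Fin (suc u)) → Fin (2 ^ toℕ d) → Vtx lam u m N
  lv   : Fin lam → Fin (2 ^ u) → Vtx lam u m N
  rv   : Fin lam → Fin (2 ^ u) → Vtx lam u m N
  yv   : Fin lam → Fin m → Vtx lam u m N
  zv   : Fin lam → Fin (suc u) → Vtx lam u m N

GV : ℕ → ℕ → ℕ → Set
GV lam n m = Vtx lam (uOf n) m (NOf lam n m)

eqF : ∀ {a b} → Fin a → Fin b → Bool
eqF i j = toℕ i ≡ᵇ toℕ j

GG : ∀ lam n m → (Fin m → Subset n) → Graph {GV lam n m}
GG lam n m S src (node i d a) = toℕ d ≡ᵇ 0
GG lam n m S (node i d a) (node i' d' b) =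
  eqF i i' ∧ (toℕ d' ≡ᵇ suc (toℕ d)) ∧
  ((toℕ b ≡ᵇ 2 * toℕ a) ∨ (toℕ b ≡ᵇ suc (2 * toℕ a)))
GG lam n m S (node i d a) (lv i' x) = eqF i i' ∧ (toℕ d ≡ᵇ uOf n) ∧ eqF a x
GG lam n m S (node i d a) (rv i' x) = eqF i i' ∧ (toℕ d ≡ᵇ uOf n) ∧ eqF a x
GG lam n m S (lv i x) (yv i' W) = eqF i i' ∧ padMem S W x
GG lam n m S (rv i x) (zv i' q) = eqF i i'
GG lam n m S (yv i W) (vv j) = true
GG lam n m S (zv i q) (vv j) = true
GG lam n m S _ _ = false

allV : ∀ lam n m → List (GV lam n m)
allV lam n m =
  src ∷ map vv (allFin (NOf lam n m)) ++
  concatMap (λ i →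
      concatMap (λ d → map (node i d) (allFin (2 ^ toℕ d))) (allFin (suc (uOf n)))
   ++ map (lv i) (allFin (2 ^ uOf n))
   ++ map (rv i) (allFin (2 ^ uOf n))
   ++ map (yv i) (allFin m)
   ++ map (zv i) (allFin (suc (uOf n))))
    (allFin lam)

inDeg : ∀ lam n m → Graph {GV lam n m} → GV lam n m → ℕ
inDeg lam n m H v = countIn H (allV lam n m) v

-- Fix a sink v_j, a tree B_i and an element x. Delete the u edges that leave the root-to-x_i path
-- of B_i sideways, and the edge x_i → r(x_i): k = u + 1 faults. Afterwards G still has λ
-- edge-disjoint s–v_j paths, one per tree (through ℓ(x_i) and some y_{i,W} with x ∈ W in B_i,
-- through r(x_{i'}) and Z_{i'} elsewhere), and no more, since every s–v_j path starts with one of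
-- the λ edges s → r_{i'}. So H minus the faults also has λ such paths; they use every edge out of
-- s, and the one entering B_i is forced down to x_i and through ℓ(x_i) to some y_{i,W} with x ∈ W
-- and y_{i,W} → v_j in H. Hence, for all i and j, the sets W with y_{i,W} → v_j in H cover U. For
-- fixed j these λ covers use disjoint in-edges of v_j, so the smallest has size at most
-- in(v_j, H)/λ; taking j with v_j of least in-degree gives the bound for every j.

module Submission where

open import Defs
open import Data.Bool using (T; true; false; _∨_; if_then_else_)
open import Data.Bool.Properties using (T-∧; T-∨; T-≡)
open import Data.Empty using (⊥-elim)
open import Data.Fin using (Fin; zero; suc; toℕ; fromℕ; fromℕ<; inject₁; inject≤; punchOut)
open import Data.Fin.Properties
  using (_≟_; any?; injective⇒≤; punchOut-injective; toℕ-injective; toℕ<n; toℕ-fromℕ; toℕ-fromℕ<;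
         toℕ-inject₁; toℕ-inject≤)
open import Data.Fin.Subset using (Subset; ∣_∣; inside; outside) renaming (_∈_ to _∈ₛ_)
open import Data.List using (List; []; _∷_; _++_; map; length; concatMap; tabulate; allFin)
open import Data.List.Membership.Propositional using (_∈_)
open import Data.List.Membership.Propositional.Properties using (∈-map⁻; ∈-map⁺; ∈-allFin)
open import Data.List.Properties using (length-map; length-tabulate; map-tabulate)
open import Data.List.Relation.Unary.All as All using (All; []; _∷_)
import Data.List.Relation.Unary.All.Properties as Allₚ
open import Data.List.Relation.Binary.Sublist.Propositional using (_⊆_; []; _∷_; _∷ʳ_; ⊆-refl)
open import Data.List.Relation.Binary.Sublist.Propositional.Properties using (++⁺ˡ; ++⁺ʳ)
open import Data.List.Relation.Unary.AllPairs using ([]; _∷_)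
open import Data.List.Relation.Unary.Any using (here; there)
open import Data.List.Relation.Unary.Unique.Propositional using (Unique)
open import Data.Maybe using (Maybe; just; nothing; _<∣>_)
open import Data.Maybe.Properties using (just-injective)
open import Data.Nat
  using (ℕ; zero; suc; _+_; _*_; _∸_; _^_; _≤_; _<_; _≡ᵇ_; _<?_; z≤n; s≤s; s≤s⁻¹;
         ⌊_/2⌋; ⌈_/2⌉; parity)
open import Data.Nat.Induction using (<-rec)
open import Data.Nat.Logarithm using (⌈log₂_⌉; ⌈log₂⌈n/2⌉⌉≡⌈log₂n⌉∸1)
open import Data.Nat.Properties
  using (≤-refl; ≤-reflexive; ≤-trans; ≤-<-trans; <⇒≤; <⇒≱; 1+n≰n; 1+n≢n; n≤1+n; n<1⇒n≡0;
         suc-injective; ≡ᵇ⇒≡; ≡⇒≡ᵇ; +-assoc; +-suc; *-suc; m≤m+n; m≤n+m;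
         +-mono-≤; +-monoˡ-≤; +-monoʳ-≤; *-mono-≤; *-monoʳ-≤; *-monoʳ-<; *-cancelˡ-<;
         m^n>0; m∸n+n≡m; n∸n≡0; +-∸-assoc;
         ⌊n/2⌋+⌈n/2⌉≡n; ⌊n/2⌋≤⌈n/2⌉; ⌈n/2⌉<n; ≤-totalOrder; module ≤-Reasoning)
open import Data.List.Extrema ≤-totalOrder using (argmin; f[argmin]≤f[xs])
open import Data.Parity using (Parity; 0ℙ; 1ℙ; _⁻¹)
import Data.Parity.Properties as ℙ
open import Data.Product using (Σ; ∃; _×_; _,_; proj₁; proj₂)
open import Data.Sum using (inj₁; inj₂)
open import Data.Vec using (lookup)
import Data.Vec as Vec
open import Data.Vec.Properties using ([]=⇒lookup; lookup⇒[]=; lookup∘tabulate)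
open import Function using (_∘_; id)
open import Function.Bundles using (module Equivalence)
open import Function.Definitions using (Injective)
open import Relation.Nullary using (¬_; yes; no; contradiction)
open import Relation.Binary.PropositionalEquality

open Equivalence using (to; from)

injective⇒surjective : ∀ {k} {f : Fin k → Fin k} → Injective _≡_ _≡_ f →
                       ∀ y → ∃ λ x → f x ≡ y
injective⇒surjective {suc k} {f} f-inj y with any? (λ x → f x ≟ y)
... | yes hit = hit
... | no miss = contradiction (injective⇒≤ g-inj) 1+n≰n
  where
  g : Fin (suc k) → Fin k
  g x = punchOut {i = y} (λ y≡fx → miss (x , sym y≡fx))
  g-inj : Injective _≡_ _≡_ g
  g-inj {x} {x′} = f-inj ∘ punchOut-injective {i = y} _ _

module _ {V : Set} where

  walk-map : ∀ {E E′ : EdgeRel {V}} → (∀ {a b} → E a b → E′ a b) →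
             ∀ {s t} → Walk E s t → Walk E′ s t
  walk-map f stop       = stop
  walk-map f (step e p) = step (f e) (walk-map f p)

  module _ {E : EdgeRel {V}} (rank : V → ℕ) (rank-< : ∀ {a b} → E a b → rank a < rank b) where

    walk-rank-≥ : ∀ {s t} (p : Walk E s t) → All (λ w → rank s ≤ rank w) (walkVerts p)
    walk-rank-≥ stop       = ≤-refl ∷ []
    walk-rank-≥ (step e p) = ≤-refl ∷ All.map (≤-trans (<⇒≤ (rank-< e))) (walk-rank-≥ p)

    walk-unique : ∀ {s t} (p : Walk E s t) → Unique (walkVerts p)
    walk-unique stop       = [] ∷ []
    walk-unique (step e p) =
      All.map (λ s≤w s≡w → <⇒≱ (rank-< e) (subst (λ w → _ ≤ rank w) (sym s≡w) s≤w))
              (walk-rank-≥ p)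
      ∷ walk-unique p

  module _ {C : Set} (colour : V × V → C) where

    Coloured : EdgeRel {V} → C → EdgeRel {V}
    Coloured E c a b = E a b × colour (a , b) ≡ c

    walk-colour : ∀ {E c s t} (p : Walk (Coloured E c) s t) →
                  All (λ e → colour e ≡ c) (walkEdges (walk-map proj₁ p))
    walk-colour stop             = []
    walk-colour (step (_ , c) p) = c ∷ walk-colour p

    colouredFlow : ∀ {E s t n} (rank : V → ℕ) → (∀ {a b} → E a b → rank a < rank b) →
                   (κ : Fin n → C) → Injective _≡_ _≡_ κ →
                   (∀ q → Walk (Coloured E (κ q)) s t) → HasFlow E s t n
    colouredFlow rank rank-< κ κ-inj walks =
      (λ q → walk-map proj₁ (walks q) , walk-unique rank rank-< (walk-map proj₁ (walks q))) ,
      λ q r q≢r e e∈q e∈r → q≢r (κ-inj (trans (sym (All.lookup (walk-colour (walks q)) e∈q))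
                                             (All.lookup (walk-colour (walks r)) e∈r)))

  walk-along : ∀ {E : EdgeRel {V}} {h t} (f : Fin (suc h) → V) →
               (∀ k → E (f (inject₁ k)) (f (suc k))) → Walk E (f (fromℕ h)) t → Walk E (f zero) t
  walk-along {h = zero}  f edges rest = rest
  walk-along {h = suc h} f edges rest = step (edges zero) (walk-along (f ∘ suc) (edges ∘ suc) rest)

  module _ {E : EdgeRel {V}} {s t : V} {k : ℕ} (exit : Fin k → V × V)
           (cross : Walk E s t → Fin k) (cross-∈ : ∀ p → exit (cross p) ∈ walkEdges p) where

    crossing : ∀ {n} → HasFlow E s t n → Fin n → Fin k
    crossing (paths , _) q = cross (proj₁ (paths q))

    crossing-injective : ∀ {n} (flow : HasFlow E s t n) → Injective _≡_ _≡_ (crossing flow)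
    crossing-injective (paths , disjoint) {q} {r} same with q ≟ r
    ... | yes q≡r = q≡r
    ... | no  q≢r = ⊥-elim (disjoint q r q≢r _ (cross-∈ _)
                             (subst (λ i → exit i ∈ _) (sym same) (cross-∈ _)))

    flow≤cut : ∀ {n} → HasFlow E s t n → n ≤ k
    flow≤cut flow = injective⇒≤ (crossing-injective flow)

    cut-saturated : (flow : HasFlow E s t k) → ∀ i → ∃ λ q → crossing flow q ≡ i
    cut-saturated flow = injective⇒surjective (crossing-injective flow)

  module _ (H : Graph {V}) (v : V) where

    countIn-++ : ∀ xs ys → countIn H (xs ++ ys) v ≡ countIn H xs v + countIn H ys v
    countIn-++ []       ys = refl
    countIn-++ (w ∷ xs) ys = trans (cong (b +_) (countIn-++ xs ys)) (sym (+-assoc b _ _))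
      where
      b : ℕ
      b = if H w v then 1 else 0

    countIn-concatMap-≥ : ∀ {A : Set} {a} (f : A → List V) xs →
                          All (λ x → a ≤ countIn H (f x) v) xs →
                          length xs * a ≤ countIn H (concatMap f xs) v
    countIn-concatMap-≥ f []       []         = z≤n
    countIn-concatMap-≥ f (x ∷ xs) (a≤ ∷ as≤) =
      subst (_ ≤_) (sym (countIn-++ (f x) (concatMap f xs)))
            (+-mono-≤ a≤ (countIn-concatMap-≥ f xs as≤))

    countIn-mono : ∀ {xs ys} → xs ⊆ ys → countIn H xs v ≤ countIn H ys v
    countIn-mono []         = z≤n
    countIn-mono (_ ∷ʳ sub) = ≤-trans (countIn-mono sub) (m≤n+m _ _)
    countIn-mono (refl ∷ sub) = +-monoʳ-≤ _ (countIn-mono sub)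

    countIn-tabulate : ∀ {k} (f : Fin k → V) →
                       countIn H (tabulate f) v ≡ ∣ Vec.tabulate (λ a → H (f a) v) ∣
    countIn-tabulate {zero}  f = refl
    countIn-tabulate {suc k} f with H (f zero) v
    ... | true  = cong suc (countIn-tabulate (f ∘ suc))
    ... | false = countIn-tabulate (f ∘ suc)

minimiser : ∀ {k} (f : Fin k → ℕ) → Fin k → ∃ λ a → ∀ b → f a ≤ f b
minimiser {k} f default =
  argmin f default (allFin k) , λ b → All.lookup (f[argmin]≤f[xs] default (allFin k)) (∈-allFin b)

n≤2^⌈log₂n⌉ : ∀ n → n ≤ 2 ^ ⌈log₂ n ⌉
n≤2^⌈log₂n⌉ = <-rec _ bound
  where
  bound : ∀ n → (∀ {m} → m < n → m ≤ 2 ^ ⌈log₂ m ⌉) → n ≤ 2 ^ ⌈log₂ n ⌉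
  bound zero          _   = z≤n
  bound (suc zero)    _   = ≤-refl
  -- for n ≥ 2, ⌈log₂ n⌉ computes to a successor, which makes the last step definitional
  bound n@(suc (suc k)) rec = begin
    n                            ≡⟨ sym (⌊n/2⌋+⌈n/2⌉≡n n) ⟩
    ⌊ n /2⌋ + ⌈ n /2⌉            ≤⟨ +-monoˡ-≤ _ (⌊n/2⌋≤⌈n/2⌉ n) ⟩
    ⌈ n /2⌉ + ⌈ n /2⌉            ≤⟨ +-mono-≤ half≤ (≤-trans half≤ (m≤m+n _ 0)) ⟩
    2 * 2 ^ (⌈log₂ n ⌉ ∸ 1)      ≡⟨⟩
    2 ^ ⌈log₂ n ⌉                ∎
    where
    open ≤-Reasoning
    half≤ : ⌈ n /2⌉ ≤ 2 ^ (⌈log₂ n ⌉ ∸ 1)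
    half≤ = subst (λ e → ⌈ n /2⌉ ≤ 2 ^ e) (⌈log₂⌈n/2⌉⌉≡⌈log₂n⌉∸1 n) (rec (⌈n/2⌉<n k))

-- In GG, node a at depth d of a tree has the children 2a = childOf a 0ℙ and 2a + 1 = childOf a 1ℙ at
-- depth d + 1. Hence the ancestor at depth d of leaf x is ancestor (u ∸ d) x = ⌊x / 2^(u ∸ d)⌋, and
-- the root-to-x path turns towards parity (pos (d + 1)) below depth d.
childOf : ℕ → Parity → ℕ
childOf p 0ℙ = 2 * p
childOf p 1ℙ = suc (2 * p)

childOf-suc : ∀ p t → childOf (suc p) t ≡ 2 + childOf p t
childOf-suc p 0ℙ = *-suc 2 p
childOf-suc p 1ℙ = cong suc (*-suc 2 p)

childOf-⌊/2⌋ : ∀ c → childOf ⌊ c /2⌋ (parity c) ≡ c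
childOf-⌊/2⌋ zero          = refl
childOf-⌊/2⌋ (suc zero)    = refl
childOf-⌊/2⌋ (suc (suc c)) = trans (childOf-suc _ (parity c)) (cong (2 +_) (childOf-⌊/2⌋ c))

childOf-injective : ∀ p {t t′} → childOf p t ≡ childOf p t′ → t ≡ t′
childOf-injective p {0ℙ} {0ℙ} _  = refl
childOf-injective p {0ℙ} {1ℙ} eq = contradiction (sym eq) 1+n≢n
childOf-injective p {1ℙ} {0ℙ} eq = contradiction eq 1+n≢n
childOf-injective p {1ℙ} {1ℙ} _  = refl

≢⇒≡⁻¹ : ∀ {p q : Parity} → p ≢ q → p ≡ q ⁻¹
≢⇒≡⁻¹ {0ℙ} {0ℙ} p≢q = contradiction refl p≢q
≢⇒≡⁻¹ {0ℙ} {1ℙ} _   = refl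
≢⇒≡⁻¹ {1ℙ} {0ℙ} _   = refl
≢⇒≡⁻¹ {1ℙ} {1ℙ} p≢q = contradiction refl p≢q

2*p≤childOf : ∀ p t → 2 * p ≤ childOf p t
2*p≤childOf p 0ℙ = ≤-refl
2*p≤childOf p 1ℙ = n≤1+n _

childOf-< : ∀ {p z} t → p < z → childOf p t < 2 * z
childOf-< 0ℙ p<z = *-monoʳ-< 2 p<z
childOf-< {p} {z} 1ℙ p<z = subst (_≤ 2 * z) (*-suc 2 p) (*-monoʳ-≤ 2 p<z)

⌊n/2⌋<m : ∀ {n m} → n < 2 * m → ⌊ n /2⌋ < m
⌊n/2⌋<m {n} n<2m =
  *-cancelˡ-< 2 _ _
    (≤-<-trans (2*p≤childOf _ (parity n)) (subst (_< _) (sym (childOf-⌊/2⌋ n)) n<2m))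

ancestor : ℕ → ℕ → ℕ
ancestor zero    c = c
ancestor (suc h) c = ⌊ ancestor h c /2⌋

ancestor-< : ∀ h {b c} → c < 2 ^ (h + b) → ancestor h c < 2 ^ b
ancestor-< zero        c< = c<
ancestor-< (suc h) {b} {c} c< =
  ⌊n/2⌋<m (ancestor-< h (subst (λ e → c < 2 ^ e) (sym (+-suc h b)) c<))

module LeafPath {u : ℕ} (x : Fin (2 ^ u)) where

  pos : ℕ → ℕ
  pos d = ancestor (u ∸ d) (toℕ x)

  pos-< : ∀ {d} → d ≤ u → pos d < 2 ^ d
  pos-< {d} d≤u = ancestor-< (u ∸ d) (subst (λ e → toℕ x < 2 ^ e) (sym (m∸n+n≡m d≤u)) (toℕ<n x))

  pos-leaf : pos u ≡ toℕ x
  pos-leaf = cong (λ h → ancestor h (toℕ x)) (n∸n≡0 u)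

  pos-root : pos 0 ≡ 0
  pos-root = n<1⇒n≡0 (pos-< z≤n)

  turn : ℕ → Parity
  turn d = parity (pos (suc d))

  pos-suc : ∀ {d} → d < u → pos (suc d) ≡ childOf (pos d) (turn d)
  pos-suc {d} d<u = begin
    pos (suc d)                                ≡⟨ sym (childOf-⌊/2⌋ _) ⟩
    childOf ⌊ pos (suc d) /2⌋ (turn d)         ≡⟨ cong (λ h → childOf (ancestor h (toℕ x)) (turn d))
                                                       (+-∸-assoc 1 d<u) ⟨
    childOf (pos d) (turn d)                   ∎
    where open ≡-Reasoning

  -- split at the root so that the path starts definitionally at node i zero zero
  position : (d : Fin (suc u)) → Fin (2 ^ toℕ d)
  position zero      = zero
  position d@(suc _) = fromℕ< (pos-< (s≤s⁻¹ (toℕ<n d)))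

  toℕ-position : ∀ d → toℕ (position d) ≡ pos (toℕ d)
  toℕ-position zero    = sym pos-root
  toℕ-position (suc d) = toℕ-fromℕ< _

  sibling : (k : Fin u) → Fin (2 ^ suc (toℕ k))
  sibling k = fromℕ< (childOf-< (turn (toℕ k) ⁻¹) (pos-< (<⇒≤ (toℕ<n k))))

  position-leaf : toℕ (position (fromℕ u)) ≡ toℕ x
  position-leaf = trans (toℕ-position (fromℕ u)) (trans (cong pos (toℕ-fromℕ u)) pos-leaf)

  position-inject₁ : ∀ k → toℕ (position (inject₁ k)) ≡ pos (toℕ k)
  position-inject₁ k = trans (toℕ-position (inject₁ k)) (cong pos (toℕ-inject₁ k))

  position-suc : ∀ k → toℕ (position (suc k)) ≡ childOf (toℕ (position (inject₁ k))) (turn (toℕ k))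
  position-suc k = begin
    toℕ (position (suc k))                            ≡⟨ toℕ-position (suc k) ⟩
    pos (suc (toℕ k))                                 ≡⟨ pos-suc (toℕ<n k) ⟩
    childOf (pos (toℕ k)) (turn (toℕ k))
      ≡⟨ cong (λ p → childOf p (turn (toℕ k))) (position-inject₁ k) ⟨
    childOf (toℕ (position (inject₁ k))) (turn (toℕ k)) ∎
    where open ≡-Reasoning

  sibling-childOf : ∀ k → toℕ (sibling k) ≡ childOf (toℕ (position (inject₁ k))) (turn (toℕ k) ⁻¹)
  sibling-childOf k =
    trans (toℕ-fromℕ< _) (cong (λ p → childOf p (turn (toℕ k) ⁻¹)) (sym (position-inject₁ k)))

  sibling-off-path : ∀ k → toℕ (sibling k) ≢ pos (suc (toℕ k))
  sibling-off-path k eq = ℙ.p≢p⁻¹ (turn (toℕ k))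
    (sym (childOf-injective _ (trans (sym (toℕ-fromℕ< _)) (trans eq (pos-suc (toℕ<n k))))))

module Reduction (lam n m : ℕ) (S : Fin m → Subset n) where

  u : ℕ
  u = uOf n

  V : Set
  V = GV lam n m

  G : Graph {V}
  G = GG lam n m S

  -- Equivalent to T (G a b) (see arc and arc⁻), but indexed so that matching on an edge
  -- determines its endpoints.
  data Arc : V → V → Set where
    root   : ∀ {i} {a : Fin 1} → Arc src (node i zero a)
    child  : ∀ {i} (k : Fin u) {a b} t → toℕ b ≡ childOf (toℕ a) t →
             Arc (node i (inject₁ k) a) (node i (suc k) b)
    leafˡ  : ∀ {i a y} → toℕ a ≡ toℕ y → Arc (node i (fromℕ u) a) (lv i y)
    leafʳ  : ∀ {i a y} → toℕ a ≡ toℕ y → Arc (node i (fromℕ u) a) (rv i y)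
    member : ∀ {i y W} → T (padMem S W y) → Arc (lv i y) (yv i W)
    toZ    : ∀ {i y q} → Arc (rv i y) (zv i q)
    fromY  : ∀ {i W j} → Arc (yv i W) (vv j)
    fromZ  : ∀ {i q j} → Arc (zv i q) (vv j)

  eqF⇒≡ : ∀ {k} (i i′ : Fin k) → T (eqF i i′) → i ≡ i′
  eqF⇒≡ i i′ = toℕ-injective ∘ ≡ᵇ⇒≡ (toℕ i) (toℕ i′)

  eqF-refl : ∀ {k} (i : Fin k) → T (eqF i i)
  eqF-refl i = ≡⇒≡ᵇ (toℕ i) (toℕ i) refl

  childArc : ∀ {i d d′} {a : Fin (2 ^ toℕ d)} {b : Fin (2 ^ toℕ d′)} → toℕ d′ ≡ suc (toℕ d) →
             T ((toℕ b ≡ᵇ 2 * toℕ a) ∨ (toℕ b ≡ᵇ suc (2 * toℕ a))) →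
             Arc (node i d a) (node i d′ b)
  childArc {d = d} {suc k} d′≡ b-child
    with toℕ-injective {i = d} {inject₁ k} (trans (sym (suc-injective d′≡)) (sym (toℕ-inject₁ k)))
  ... | refl with to T-∨ b-child
  ...   | inj₁ b≡2a   = child k 0ℙ (≡ᵇ⇒≡ _ _ b≡2a)
  ...   | inj₂ b≡2a+1 = child k 1ℙ (≡ᵇ⇒≡ _ _ b≡2a+1)

  ≡ᵇu⇒fromℕ : ∀ {d : Fin (suc u)} → T (toℕ d ≡ᵇ u) → d ≡ fromℕ u
  ≡ᵇu⇒fromℕ d≡u = toℕ-injective (trans (≡ᵇ⇒≡ _ _ d≡u) (sym (toℕ-fromℕ u)))

  arc : ∀ {a b} → T (G a b) → Arc a b
  arc {src} {node i zero a} _ = root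
  arc {node i d a} {node i′ d′ b} g with to T-∧ g
  ... | i≈i′ , g′ with eqF⇒≡ i i′ i≈i′ | to T-∧ g′
  ...   | refl | d′≡ , b-child = childArc (≡ᵇ⇒≡ _ _ d′≡) b-child
  arc {node i d a} {lv i′ y} g with to T-∧ g
  ... | i≈i′ , g′ with eqF⇒≡ i i′ i≈i′ | to T-∧ g′
  ...   | refl | d≡u , a≈y with ≡ᵇu⇒fromℕ {d} d≡u
  ...     | refl = leafˡ (≡ᵇ⇒≡ _ _ a≈y)
  arc {node i d a} {rv i′ y} g with to T-∧ g
  ... | i≈i′ , g′ with eqF⇒≡ i i′ i≈i′ | to T-∧ g′
  ...   | refl | d≡u , a≈y with ≡ᵇu⇒fromℕ {d} d≡u
  ...     | refl = leafʳ (≡ᵇ⇒≡ _ _ a≈y)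
  arc {lv i y} {yv i′ W} g with to T-∧ g
  ... | i≈i′ , y∈W with eqF⇒≡ i i′ i≈i′
  ...   | refl = member y∈W
  arc {rv i y} {zv i′ q} g with eqF⇒≡ i i′ g
  ... | refl = toZ
  arc {yv i W} {vv j} _ = fromY
  arc {zv i q} {vv j} _ = fromZ

  childOf⇒≡ᵇ : ∀ {a b} t → b ≡ childOf a t → T ((b ≡ᵇ 2 * a) ∨ (b ≡ᵇ suc (2 * a)))
  childOf⇒≡ᵇ 0ℙ b≡ = from T-∨ (inj₁ (≡⇒≡ᵇ _ _ b≡))
  childOf⇒≡ᵇ 1ℙ b≡ = from T-∨ (inj₂ (≡⇒≡ᵇ _ _ b≡))

  arc⁻ : ∀ {a b} → Arc a b → T (G a b)
  arc⁻ root = _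
  arc⁻ (child {i} k t b≡) =
    from T-∧ (eqF-refl i , from T-∧ (≡⇒≡ᵇ _ _ (cong suc (sym (toℕ-inject₁ k))) , childOf⇒≡ᵇ t b≡))
  arc⁻ (leafˡ {i} a≡y) =
    from T-∧ (eqF-refl i , from T-∧ (≡⇒≡ᵇ _ _ (toℕ-fromℕ u) , ≡⇒≡ᵇ _ _ a≡y))
  arc⁻ (leafʳ {i} a≡y) =
    from T-∧ (eqF-refl i , from T-∧ (≡⇒≡ᵇ _ _ (toℕ-fromℕ u) , ≡⇒≡ᵇ _ _ a≡y))
  arc⁻ (member {i} y∈W) = from T-∧ (eqF-refl i , y∈W)
  arc⁻ (toZ {i}) = eqF-refl i
  arc⁻ fromY = _
  arc⁻ fromZ = _

  level : V → ℕ
  level src          = 0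
  level (node _ d _) = suc (toℕ d)
  level (lv _ _)     = 2 + u
  level (rv _ _)     = 2 + u
  level (yv _ _)     = 3 + u
  level (zv _ _)     = 3 + u
  level (vv _)       = 4 + u

  arc-level : ∀ {a b} → Arc a b → level a < level b
  arc-level root          = s≤s z≤n
  arc-level (child k _ _) = s≤s (s≤s (≤-reflexive (toℕ-inject₁ k)))
  arc-level (leafˡ _)     = s≤s (s≤s (≤-reflexive (toℕ-fromℕ u)))
  arc-level (leafʳ _)     = s≤s (s≤s (≤-reflexive (toℕ-fromℕ u)))
  arc-level (member _)    = ≤-refl
  arc-level toZ           = ≤-refl
  arc-level fromY         = ≤-refl
  arc-level fromZ         = ≤-refl

  N : ℕ
  N = NOf lam n m

  rootOf : Fin lam → V
  rootOf i = node i zero zero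

  module Departure {E : EdgeRel {V}} (E⊆G : ∀ {a b} → E a b → T (G a b)) where

    arcOf : ∀ {a b} → E a b → Arc a b
    arcOf {a} {b} e = arc {a} {b} (E⊆G e)

    level-< : ∀ {a b} → E a b → level a < level b
    level-< = arc-level ∘ arcOf

    depart : ∀ {j} (p : Walk E src (vv j)) →
             Σ (Fin lam) λ i → (src , rootOf i) ∈ walkEdges p × Walk E (rootOf i) (vv j)
    depart (step e p) with arcOf e
    ... | root {i} {zero} = i , here refl , p

    rootEdge : Fin lam → V × V
    rootEdge i = src , rootOf i

    flow≤lam : ∀ {j c} → HasFlow E src (vv j) c → c ≤ lam
    flow≤lam = flow≤cut rootEdge (proj₁ ∘ depart) (proj₁ ∘ proj₂ ∘ depart)

    enter : ∀ {j} → HasFlow E src (vv j) lam → ∀ i → Walk E (rootOf i) (vv j)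
    enter flow i with cut-saturated rootEdge (proj₁ ∘ depart) (proj₁ ∘ proj₂ ∘ depart) flow i
    ... | q , refl = proj₂ (proj₂ (depart (proj₁ (proj₁ flow q))))

  owner : V → Maybe (Fin lam)
  owner src          = nothing
  owner (vv _)       = nothing
  owner (node i _ _) = just i
  owner (lv i _)     = just i
  owner (rv i _)     = just i
  owner (yv i _)     = just i
  owner (zv i _)     = just i

  colour : V × V → Maybe (Fin lam)
  colour (a , b) = owner a <∣> owner b

  module Faults (i : Fin lam) (x : Fin (2 ^ u)) where

    open LeafPath {u} x

    pathNode : Fin lam → Fin (suc u) → V
    pathNode i′ d = node i′ d (position d)

    pathArc : ∀ {i′} k → Arc (pathNode i′ (inject₁ k)) (pathNode i′ (suc k))
    pathArc k = child k (turn (toℕ k)) (position-suc k)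

    siblingEdge : Fin u → V × V
    siblingEdge k = pathNode i (inject₁ k) , node i (suc k) (sibling k)

    leafEdge : V × V
    leafEdge = pathNode i (fromℕ u) , rv i x

    faults : List (V × V)
    faults = leafEdge ∷ map siblingEdge (allFin u)

    faults-length : length faults ≤ kOf n
    faults-length =
      ≤-reflexive (cong suc (trans (length-map siblingEdge (allFin u)) (length-tabulate id)))

    faults⊆G : All (λ e → T (G (proj₁ e) (proj₂ e))) faults
    faults⊆G = arc⁻ (leafʳ {i} position-leaf)
             ∷ Allₚ.map⁺ (Allₚ.tabulate⁺ λ k → arc⁻ (siblingArc k))
      where
      siblingArc : ∀ k → Arc (pathNode i (inject₁ k)) (node i (suc k) (sibling k))
      siblingArc k = child k (turn (toℕ k) ⁻¹) (sibling-childOf k)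

    -- vertices off the path from the root of tree i to ℓ(x_i); every fault edge ends in one
    data Off : V → Set where
      offPath : ∀ {d b} → toℕ b ≢ pos (toℕ d) → Off (node i d b)
      offLeaf : Off (rv i x)

    faults-Off : ∀ {e} → e ∈ faults → Off (proj₂ e)
    faults-Off (here refl) = offLeaf
    faults-Off (there e∈) with ∈-map⁻ siblingEdge e∈
    ... | k , _ , refl = offPath (sibling-off-path k)

    ¬Off-pathNode : ∀ i′ d → ¬ Off (pathNode i′ d)
    ¬Off-pathNode i′ d (offPath off) = off (toℕ-position d)

    ¬Off⇒∉faults : ∀ {a b} → ¬ Off b → ¬ (a , b) ∈ faults
    ¬Off⇒∉faults ¬off = ¬off ∘ faults-Off

    module _ {j : Fin N} {W₀ : Fin m} (x∈W₀ : T (padMem S W₀ x)) where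

      TreeEdge : Fin lam → EdgeRel {V}
      TreeEdge i′ = Coloured colour (G ∖ faults) (just i′)

      treeEdge : ∀ {i′ a b} → Arc a b → ¬ Off b → colour (a , b) ≡ just i′ → TreeEdge i′ a b
      treeEdge a→b ¬off c = (arc⁻ a→b , ¬Off⇒∉faults ¬off) , c

      exitWalk : ∀ i′ → Walk (TreeEdge i′) (pathNode i′ (fromℕ u)) (vv j)
      exitWalk i′ with i′ ≟ i
      ... | yes refl = step (treeEdge (leafˡ position-leaf) (λ ()) refl)
                      (step (treeEdge (member x∈W₀) (λ ()) refl)
                      (step (treeEdge fromY (λ ()) refl) stop))
      ... | no i′≢i  = step (treeEdge (leafʳ position-leaf) (λ { offLeaf → i′≢i refl }) refl)
                      (step (treeEdge (toZ {q = zero}) (λ ()) refl)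
                      (step (treeEdge fromZ (λ ()) refl) stop))

      treeWalk : ∀ i′ → Walk (TreeEdge i′) src (vv j)
      treeWalk i′ = step (treeEdge root (¬Off-pathNode i′ zero) refl)
                    (walk-along (pathNode i′) (λ k → treeEdge (pathArc k) (¬Off-pathNode i′ (suc k)) refl)
                    (exitWalk i′))

      maxFlow : IsMaxFlow (G ∖ faults) src (vv j) lam
      maxFlow = colouredFlow colour level level-< just just-injective treeWalk ,
                λ _ → flow≤lam
        where open Departure {E = G ∖ faults} proj₁

    module Follow (H : Graph {V}) (H⊆G : Subgraph H G) {j : Fin N} where

      open Departure {E = H ∖ faults} (λ {a} {b} → H⊆G a b ∘ proj₁)

      Witness : Set
      Witness = Σ (Fin m) λ W → T (padMem S W x) × T (H (yv i W) (vv j))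

      lastEdge : ∀ {W} → Walk (H ∖ faults) (yv i W) (vv j) → (H ∖ faults) (yv i W) (vv j)
      lastEdge (step e stop) = e
      lastEdge (step e (step e′ _)) with arcOf e
      ... | fromY with arcOf e′
      ...   | ()

      followLeaf : Walk (H ∖ faults) (lv i x) (vv j) → Witness
      followLeaf (step e p) with arcOf e
      ... | member x∈W = _ , x∈W , proj₁ (lastEdge p)

      followPath : ∀ d → Walk (H ∖ faults) (pathNode i d) (vv j) → Witness
      followPath d (step e p) with arcOf e
      ... | child k t b≡ with t ℙ.≟ turn (toℕ k)
      ...   | yes refl with toℕ-injective (trans b≡ (sym (position-suc k)))
      ...     | refl = followPath (suc k) p
      followPath d (step e p) | child k t b≡ | no t≢turn
        with toℕ-injective (trans b≡ (trans (cong (childOf _) (≢⇒≡⁻¹ t≢turn)) (sym (sibling-childOf k))))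
      ... | refl = ⊥-elim (proj₂ e (there (∈-map⁺ siblingEdge (∈-allFin k))))
      followPath d (step e p) | leafˡ a≡y with toℕ-injective (trans (sym a≡y) position-leaf)
      ... | refl = followLeaf p
      followPath d (step e p) | leafʳ a≡y with toℕ-injective (trans (sym a≡y) position-leaf)
      ... | refl = ⊥-elim (proj₂ e (here refl))

      witness : HasFlow (H ∖ faults) src (vv j) lam → Witness
      witness flow = followPath zero (enter flow i)

  embed : Fin n → Fin (2 ^ u)
  embed e = inject≤ e (n≤2^⌈log₂n⌉ n)

  padMem-embed : ∀ W e → padMem S W (embed e) ≡ lookup (S W) e
  padMem-embed W e with toℕ (embed e) <? n
  ... | yes e< =
    trans (sideB-id _) (cong (lookup (S W)) (toℕ-injective (trans (toℕ-fromℕ< e<) (toℕ-inject≤ e _))))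
    where
    sideB-id : ∀ s → sideB s ≡ s
    sideB-id inside  = refl
    sideB-id outside = refl
  ... | no e≮ = contradiction (subst (_< n) (sym (toℕ-inject≤ e _)) (toℕ<n e)) e≮

  ∈⇒padMem : ∀ {W e} → e ∈ₛ S W → T (padMem S W (embed e))
  ∈⇒padMem {W} {e} e∈W = from T-≡ (trans (padMem-embed W e) ([]=⇒lookup e∈W))

  padMem⇒∈ : ∀ {W e} → T (padMem S W (embed e)) → e ∈ₛ S W
  padMem⇒∈ {W} {e} t = lookup⇒[]= e (S W) (trans (sym (padMem-embed W e)) (to T-≡ t))

  predSets : Graph {V} → Fin lam → Fin N → Subset m
  predSets H i j = Vec.tabulate (λ W → H (yv i W) (vv j))

  ∈-predSets : ∀ {H i j W} → T (H (yv i W) (vv j)) → W ∈ₛ predSets H i j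
  ∈-predSets {W = W} h = lookup⇒[]= W _ (trans (lookup∘tabulate _ W) (to T-≡ h))

  predSets-cover : IsSetCoverInstance S → ∀ H → IsFTBFP G src lam (kOf n) H →
                   ∀ i j → IsCover S (predSets H i j)
  predSets-cover inst H (H⊆G , bfp) i j e = fromWitness (witness flowH)
    where
    open Faults i (embed e)
    open Follow H H⊆G
    flowH : HasFlow (H ∖ faults) src (vv j) lam
    flowH = proj₁ (proj₁ (bfp faults faults-length faults⊆G (vv j) lam maxFlowG) ≤-refl)
      where
      maxFlowG : IsMaxFlow (G ∖ faults) src (vv j) lam
      maxFlowG = maxFlow (∈⇒padMem (proj₂ (inst e)))
    fromWitness : Witness → ∃ λ W → W ∈ₛ predSets H i j × e ∈ₛ S W
    fromWitness (W , x∈W , h) = W , ∈-predSets {H} h , padMem⇒∈ x∈W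

  -- the block of allV belonging to tree i, written so that allV unfolds to it
  treeNodes : Fin lam → List V
  treeNodes i = concatMap (λ d → map (node i d) (allFin (2 ^ toℕ d))) (allFin (suc u))

  treeVertices : Fin lam → List V
  treeVertices i =
      treeNodes i
   ++ map (lv i) (allFin (2 ^ u))
   ++ map (rv i) (allFin (2 ^ u))
   ++ map (yv i) (allFin m)
   ++ map (zv i) (allFin (suc u))

  predSets≤treeVertices : ∀ H i j → ∣ predSets H i j ∣ ≤ countIn H (treeVertices i) (vv j)
  predSets≤treeVertices H i j = begin
    ∣ predSets H i j ∣                            ≡⟨ countIn-tabulate H (vv j) (yv i) ⟨
    countIn H (tabulate (yv i)) (vv j)
      ≡⟨ cong (λ ys → countIn H ys (vv j)) (map-tabulate id (yv i)) ⟨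
    countIn H (map (yv i) (allFin m)) (vv j)      ≤⟨ countIn-mono H (vv j) ys⊆ ⟩
    countIn H (treeVertices i) (vv j)             ∎
    where
    open ≤-Reasoning
    ys⊆ : map (yv i) (allFin m) ⊆ treeVertices i
    ys⊆ = ++⁺ˡ (treeNodes i) (++⁺ˡ (map (lv i) (allFin (2 ^ u))) (++⁺ˡ (map (rv i) (allFin (2 ^ u)))
            (++⁺ʳ (map (zv i) (allFin (suc u))) ⊆-refl)))

  inDeg-≥ : ∀ H j {a} → (∀ i → a ≤ ∣ predSets H i j ∣) → lam * a ≤ inDeg lam n m H (vv j)
  inDeg-≥ H j {a} a≤ = begin
    lam * a                                                 ≡⟨ cong (_* a) (length-tabulate {n = lam} id) ⟨
    length (allFin lam) * a                                 ≤⟨ countIn-concatMap-≥ H (vv j) treeVertices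
                                                                 (allFin lam) (Allₚ.tabulate⁺ a≤trees) ⟩
    countIn H (concatMap treeVertices (allFin lam)) (vv j)  ≤⟨ countIn-mono H (vv j) trees⊆ ⟩
    inDeg lam n m H (vv j)                                  ∎
    where
    open ≤-Reasoning
    a≤trees : ∀ i → a ≤ countIn H (treeVertices i) (vv j)
    a≤trees i = ≤-trans (a≤ i) (predSets≤treeVertices H i j)
    trees⊆ : concatMap treeVertices (allFin lam) ⊆ allV lam n m
    trees⊆ = src ∷ʳ ++⁺ˡ _ ⊆-refl

  0<N : 1 ≤ lam → 0 < N
  0<N 1≤lam = *-mono-≤ (*-mono-≤ (s≤s (z≤n {3})) 1≤lam) (≤-trans (m^n>0 2 u) (m≤n+m _ m))

lemma2 : (lam n m : ℕ) (S : Fin m → Subset n) → 1 ≤ lam →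
         IsSetCoverInstance S →
         (H : Graph {GV lam n m}) →
         IsFTBFP (GG lam n m S) src lam (kOf n) H →
         Σ (Subset m) λ C → IsCover S C ×
           (∀ (j : Fin (NOf lam n m)) → lam * ∣ C ∣ ≤ inDeg lam n m H (vv j))
lemma2 lam n m S 1≤lam inst H bfp =
  predSets H i* j* , predSets-cover inst H bfp i* j* ,
  λ j → ≤-trans (inDeg-≥ H j* (proj₂ fewestSets)) (proj₂ smallestInDeg j)
  where
  open Reduction lam n m S
  smallestInDeg : ∃ λ j → ∀ j′ → inDeg lam n m H (vv j) ≤ inDeg lam n m H (vv j′)
  smallestInDeg = minimiser (λ j → inDeg lam n m H (vv j)) (fromℕ< (0<N 1≤lam))
  j* : Fin N
  j* = proj₁ smallestInDeg
  fewestSets : ∃ λ i → ∀ i′ → ∣ predSets H i j* ∣ ≤ ∣ predSets H i′ j* ∣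
  fewestSets = minimiser (λ i → ∣ predSets H i j* ∣) (fromℕ< 1≤lam)
  i* : Fin lam
  i* = proj₁ fewestSets
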